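{- Let $M$ be a matroid and $k\geq 0$ an integer such that $\mathrm{rank}(M)\geq k$ (i.e., $M$ has an independent set of size $k$). Let \[\mathcal{I}[k]=\{I\in\mathcal{I}(M): \exists J\in\mathcal{I}(M)\text{ with } I\subseteq J\text{ and }|J\setminus I|=k\}.\] Then $M[k]:=(E(M),\mathcal{I}[k])$ is a matroid.
   Context: Matroids may be infinite: a matroid on $E$ is a pair $(E,\mathcal{I})$ with $\mathcal{I}\subseteq\mathcal{P}(E)$ satisfying (I1) $\emptyset\in\mathcal{I}$; (I2) closure under subsets; (I3) whenever $I,I'\in\mathcal{I}$ with $I'$ maximal and $I$ not maximal, there is $x\in I'\setminus I$ with $I+x\in\mathcal{I}$; (IM) whenever $I\subseteq X\subseteq E$ and $I\in\mathcal{I}$, the set $\{I'\in\mathcal{I}: I\subseteq I'\subseteq X\}$ has a maximal element. -}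

module Defs where

open import Data.Bool using (Bool; true; false; _∧_; not)
open import Data.Nat using (ℕ)
open import Data.Fin using (Fin)
open import Data.Product using (Σ; Σ-syntax; _×_)
open import Data.Sum using (_⊎_)
open import Relation.Binary.PropositionalEquality using (_≡_)
open import Relation.Nullary using (¬_)
open import Function.Bundles using (_↔_; _⇔_)

-- Subsets of a ground type E, as characteristic functions
-- (classically every subset has one; this keeps membership proof-irrelevant).
Subset : Set → Set
Subset E = E → Bool

module _ {E : Set} where

  _∈_ : E → Subset E → Set
  x ∈ A = A x ≡ true

  _⊆_ : Subset E → Subset E → Set
  A ⊆ B = ∀ x → x ∈ A → x ∈ B

  _∖_ : Subset E → Subset E → Subset E
  (A ∖ B) x = A x ∧ not (B x)

  IsInsert : Subset E → E → Subset E → Set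
  IsInsert I x J = ∀ y → (y ∈ J) ⇔ (y ∈ I ⊎ y ≡ x)

  HasSize : Subset E → ℕ → Set
  HasSize A k = Fin k ↔ Σ E (λ x → x ∈ A)

  Maximal : (Subset E → Set) → Subset E → Set
  Maximal 𝓕 A = 𝓕 A × (∀ B → 𝓕 B → A ⊆ B → B ⊆ A)

record IsMatroid (E : Set) (𝓘 : Subset E → Set) : Set₁ where
  field
    I1 : 𝓘 (λ _ → false)
    I2 : ∀ I J → 𝓘 J → I ⊆ J → 𝓘 I
    I3 : ∀ I I' → 𝓘 I → Maximal 𝓘 I' → ¬ Maximal 𝓘 I →
         Σ[ x ∈ E ] (x ∈ (I' ∖ I) × (∀ J → IsInsert I x J → 𝓘 J))
    IM : ∀ I X → 𝓘 I → I ⊆ X →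
         Σ[ B ∈ Subset E ] Maximal (λ I' → 𝓘 I' × I ⊆ I' × I' ⊆ X) B

record Matroid (E : Set) : Set₁ where
  field
    indep     : Subset E → Set
    isMatroid : IsMatroid E indep

open Matroid public

indep[_] : {E : Set} → ℕ → Matroid E → Subset E → Set
indep[ k ] M I =
  indep M I × Σ[ J ∈ Subset _ ] (indep M J × I ⊆ J × HasSize (J ∖ I) k)

-- Call J ⊇ I an n-extension of I if J is independent and |J ∖ I| = n, so that 𝓘[k] is the
-- family of sets with a k-extension. By repeated basis exchange, every extension of I can be
-- moved into any base B; hence no extension of I is larger than |B ∖ I|.
-- (I3): a non-maximal I ∈ 𝓘[k] has a (k+1)-extension. If I′ is maximal with k-extension f and
-- B ⊇ I′ ∪ f is a base, then B ∖ I′ consists of f alone, so after moving the (k+1)-extension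
-- of I into B one of its elements x lies in I′ (pigeonhole), and dropping x from it leaves a
-- k-extension of I + x.
-- (IM): take BX maximal among the independent sets between I and X, and a base B ⊇ BX. If
-- |B ∖ BX| ≥ k, BX is the maximal element. Otherwise remove elements of BX ∖ I until the
-- remaining I′ has |B ∖ I′| = k; I′ ∈ 𝓘[k], and it is maximal as no extension of I′
-- exceeds |B ∖ I′|.
module Submission where

open import Defs
open import Level using (0ℓ)
open import Axiom.ExcludedMiddle using (ExcludedMiddle)
open import Axiom.DoubleNegationElimination using (em⇒dne)
open import Axiom.UniquenessOfIdentityProofs using (module Decidable⇒UIP)
open import Data.Bool using (true; false)
open import Data.Empty using (⊥-elim)
import Data.Bool.Properties as Bool
open import Data.Fin using (Fin; zero; suc; splitAt; _↑ˡ_; _↑ʳ_; punchIn)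
open import Data.Fin.Properties
  using (injective⇒≤; suc-injective; punchIn-injective; punchInᵢ≢i; +↔⊎)
open import Data.Nat using (ℕ; zero; suc; _+_; _≤_; _<_)
open import Data.Nat.Properties using (1+n≰n; <⇒≤; <⇒≱; m<n⇒m<1+n; n<1+n; +-monoʳ-<; m≤n⇒∃[o]m+o≡n)
open import Data.Product using (Σ; Σ-syntax; ∃; _×_; _,_; proj₁; proj₂)
open import Data.Sum using (_⊎_; inj₁; inj₂; [_,_])
open import Data.Vec.Functional using (Vector; []; _∷_; _++_; removeAt)
open import Data.Vec.Functional.Properties using (lookup-++ˡ; lookup-++ʳ)
open import Function.Base using (_∘_; id)
open import Function.Bundles using (Inverse; Injection; Equivalence; mk↔ₛ′; mk⇔)
open import Function.Definitions using (Injective)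
open import Function.Properties.Inverse using (↔⇒↣)
open import Relation.Nullary using (¬_; yes; no; does; contradiction)
open import Relation.Binary.PropositionalEquality
  using (_≡_; _≢_; refl; sym; cong; subst; module ≡-Reasoning)

module _ {A : Set} where

  infix 4 _∉_ _∈ᵥ_ _⊆ᵥ_

  _∉_ : A → Subset A → Set
  x ∉ S = ¬ x ∈ S

  ⊆-trans : ∀ {R S T : Subset A} → R ⊆ S → S ⊆ T → R ⊆ T
  ⊆-trans R⊆S S⊆T x = S⊆T x ∘ R⊆S x

  ∈-∖⁺ : ∀ (S T : Subset A) {x} → x ∈ S → x ∉ T → x ∈ (S ∖ T)
  ∈-∖⁺ S T {x} x∈S x∉T with S x | T x
  ... | true  | true  = contradiction refl x∉T
  ... | true  | false = refl
  ... | false | _     = x∈S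

  ∈-∖⁻ : ∀ (S T : Subset A) {x} → x ∈ (S ∖ T) → x ∈ S × x ∉ T
  ∈-∖⁻ S T {x} x∈S∖T with S x | T x
  ... | true  | false = refl , λ ()
  ... | true  | true  = contradiction x∈S∖T λ ()
  ... | false | _     = contradiction x∈S∖T λ ()

  _∈ᵥ_ : ∀ {n} → A → Vector A n → Set
  y ∈ᵥ d = ∃ λ i → d i ≡ y

  _⊆ᵥ_ : ∀ {n} → Subset A → Vector A n → Set
  S ⊆ᵥ d = ∀ {y} → y ∈ S → y ∈ᵥ d

  Distinct : (A → Set) → ℕ → Set
  Distinct P n = Σ[ d ∈ Vector A n ] (Injective _≡_ _≡_ d × ∀ i → P (d i))

  record Enumeration (P : A → Set) (n : ℕ) : Set where
    field
      elements  : Vector A n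
      injective : Injective _≡_ _≡_ elements
      sound     : ∀ i → P (elements i)
      complete  : ∀ {y} → P y → y ∈ᵥ elements

  injective-⊆-image⇒≤ : ∀ {m n} {d : Vector A n} {s : Vector A m} →
                        Injective _≡_ _≡_ d → (∀ i → d i ∈ᵥ s) → n ≤ m
  injective-⊆-image⇒≤ {d = d} {s} d-inj d⊆s = injective⇒≤ index-injective
    where
      open ≡-Reasoning
      index-injective : Injective _≡_ _≡_ (proj₁ ∘ d⊆s)
      index-injective {i} {j} eq = d-inj (begin
        d i                  ≡⟨ proj₂ (d⊆s i) ⟨
        s (proj₁ (d⊆s i))    ≡⟨ cong s eq ⟩
        s (proj₁ (d⊆s j))    ≡⟨ proj₂ (d⊆s j) ⟩
        d j                  ∎)

  injective-∷ : ∀ {n x} {d : Vector A n} →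
                ¬ x ∈ᵥ d → Injective _≡_ _≡_ d → Injective _≡_ _≡_ (x ∷ d)
  injective-∷ x∉d d-inj {zero}  {zero}  _  = refl
  injective-∷ x∉d d-inj {zero}  {suc j} eq = contradiction (j , sym eq) x∉d
  injective-∷ x∉d d-inj {suc i} {zero}  eq = contradiction (i , eq) x∉d
  injective-∷ x∉d d-inj {suc i} {suc j} eq = cong suc (d-inj eq)

  injective-++ : ∀ {m n} {u : Vector A m} {v : Vector A n} →
                 Injective _≡_ _≡_ u → Injective _≡_ _≡_ v → (∀ i j → u i ≢ v j) →
                 Injective _≡_ _≡_ (u ++ v)
  injective-++ {m} {n} {u} {v} u-inj v-inj u≢v eq =
    Injection.injective (↔⇒↣ (+↔⊎ {m} {n})) ([u,v]-injective _ _ eq)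
    where
      [u,v]-injective : ∀ p q → [ u , v ] p ≡ [ u , v ] q → p ≡ q
      [u,v]-injective (inj₁ i) (inj₁ j) e = cong inj₁ (u-inj e)
      [u,v]-injective (inj₁ i) (inj₂ j) e = contradiction e (u≢v i j)
      [u,v]-injective (inj₂ i) (inj₁ j) e = contradiction (sym e) (u≢v j i)
      [u,v]-injective (inj₂ i) (inj₂ j) e = cong inj₂ (v-inj e)

  ∈ᵥ-++⁺ˡ : ∀ {m n y} {u : Vector A m} (v : Vector A n) → y ∈ᵥ u → y ∈ᵥ (u ++ v)
  ∈ᵥ-++⁺ˡ {u = u} v (i , refl) = i ↑ˡ _ , lookup-++ˡ u v i

  ∈ᵥ-++⁺ʳ : ∀ {m n y} (u : Vector A m) {v : Vector A n} → y ∈ᵥ v → y ∈ᵥ (u ++ v)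
  ∈ᵥ-++⁺ʳ u {v} (i , refl) = _ ↑ʳ i , lookup-++ʳ u v i

  ++-all : ∀ {m n} {P : A → Set} {u : Vector A m} {v : Vector A n} →
           (∀ i → P (u i)) → (∀ j → P (v j)) → ∀ i → P ((u ++ v) i)
  ++-all {m} {P = P} {u} {v} u-P v-P i = on-split (splitAt m i)
    where
      on-split : ∀ p → P ([ u , v ] p)
      on-split (inj₁ j) = u-P j
      on-split (inj₂ j) = v-P j

  private
    ∈-Σ-≡ : ∀ {S : Subset A} {x y} {p : x ∈ S} {q : y ∈ S} → x ≡ y →
            _≡_ {A = Σ A (_∈ S)} (x , p) (y , q)
    ∈-Σ-≡ {p = p} {q} refl = cong (_ ,_) (Decidable⇒UIP.≡-irrelevant Bool._≟_ p q)

  hasSize⇒enumeration : ∀ {S : Subset A} {n} → HasSize S n → Enumeration (_∈ S) n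
  hasSize⇒enumeration {S} S↔ = record
    { elements  = proj₁ ∘ to
    ; injective = Injection.injective (↔⇒↣ S↔) ∘ ∈-Σ-≡ {S = S}
    ; sound     = proj₂ ∘ to
    ; complete  = λ {y} y∈S → from (y , y∈S) , cong proj₁ (strictlyInverseˡ (y , y∈S))
    }
    where open Inverse S↔

  enumeration⇒hasSize : ∀ {S : Subset A} {n} → Enumeration (_∈ S) n → HasSize S n
  enumeration⇒hasSize e = mk↔ₛ′ (λ i → elements i , sound i) (λ (y , y∈S) → proj₁ (complete y∈S))
    (λ (y , y∈S) → ∈-Σ-≡ (proj₂ (complete y∈S)))
    (λ i → injective (proj₂ (complete (sound i))))
    where open Enumeration e

module Classical (lem : ExcludedMiddle 0ℓ) {E : Set} where

  dne : ∀ {P : Set} → ¬ ¬ P → P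
  dne = em⇒dne lem

  -- Kept opaque so that membership in a comprehension does not compute to a Bool
  -- equation, which keeps the sets in the lemmas below inferable.
  opaque
    ⟦_⟧ : (E → Set) → Subset E
    ⟦ P ⟧ y = does (lem {P y})

    ⟦⟧⁺ : ∀ (P : E → Set) {y} → P y → y ∈ ⟦ P ⟧
    ⟦⟧⁺ P {y} Py with lem {P y}
    ... | yes _  = refl
    ... | no ¬Py = contradiction Py ¬Py

    ⟦⟧⁻ : ∀ (P : E → Set) {y} → y ∈ ⟦ P ⟧ → P y
    ⟦⟧⁻ P {y} y∈P with lem {P y}
    ... | yes Py = Py
    ... | no _   = contradiction y∈P λ ()

  infixl 25 _∪ᵥ_

  _∪ᵥ_ : ∀ {n} → Subset E → Vector E n → Subset E
  I ∪ᵥ d = ⟦ (λ y → y ∈ I ⊎ y ∈ᵥ d) ⟧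

  module _ {n} {I : Subset E} {d : Vector E n} where

    ∪ᵥ⁺ˡ : I ⊆ I ∪ᵥ d
    ∪ᵥ⁺ˡ _ = ⟦⟧⁺ (λ y → y ∈ I ⊎ y ∈ᵥ d) ∘ inj₁

    ∪ᵥ⁺ʳ : ∀ i → d i ∈ I ∪ᵥ d
    ∪ᵥ⁺ʳ i = ⟦⟧⁺ (λ y → y ∈ I ⊎ y ∈ᵥ d) (inj₂ (i , refl))

    ∪ᵥ⁻ : ∀ {y} → y ∈ I ∪ᵥ d → y ∈ I ⊎ y ∈ᵥ d
    ∪ᵥ⁻ = ⟦⟧⁻ (λ y → y ∈ I ⊎ y ∈ᵥ d)

    ∪ᵥ-least : ∀ {B} → I ⊆ B → (∀ i → d i ∈ B) → I ∪ᵥ d ⊆ B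
    ∪ᵥ-least I⊆B d⊆B y y∈I∪d with ∪ᵥ⁻ y∈I∪d
    ... | inj₁ y∈I       = I⊆B y y∈I
    ... | inj₂ (i , refl) = d⊆B i

  insert : Subset E → E → Subset E
  insert I x = ⟦ (λ y → y ∈ I ⊎ y ≡ x) ⟧

  module _ {I : Subset E} {x : E} where

    insert⁺ : ∀ {y} → y ∈ I ⊎ y ≡ x → y ∈ insert I x
    insert⁺ = ⟦⟧⁺ (λ y → y ∈ I ⊎ y ≡ x)

    insert⁻ : ∀ {y} → y ∈ insert I x → y ∈ I ⊎ y ≡ x
    insert⁻ = ⟦⟧⁻ (λ y → y ∈ I ⊎ y ≡ x)

    insert⁺ˡ : I ⊆ insert I x
    insert⁺ˡ _ = insert⁺ ∘ inj₁

    insert⁺ʳ : x ∈ insert I x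
    insert⁺ʳ = insert⁺ (inj₂ refl)

    insert-least : ∀ {B} → I ⊆ B → x ∈ B → insert I x ⊆ B
    insert-least I⊆B x∈B y y∈I+x with insert⁻ y∈I+x
    ... | inj₁ y∈I = I⊆B y y∈I
    ... | inj₂ refl = x∈B

    isInsert-insert : IsInsert I x (insert I x)
    isInsert-insert _ = mk⇔ insert⁻ insert⁺

    isInsert⇒⊆ : ∀ {J} → IsInsert I x J → J ⊆ insert I x
    isInsert⇒⊆ J≡I+x y = insert⁺ ∘ Equivalence.to (J≡I+x y)

  ∖-⊆ᵥ-++ : ∀ {m n} {B S T : Subset E} {u : Vector E m} {v : Vector E n} →
            B ∖ S ⊆ᵥ u → S ∖ T ⊆ᵥ v → S ⊆ B → B ∖ T ⊆ᵥ (u ++ v)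
  ∖-⊆ᵥ-++ {B = B} {S} {T} {u} {v} B∖S⊆u S∖T⊆v S⊆B {y} y∈B∖T with lem {y ∈ S}
  ... | yes y∈S = ∈ᵥ-++⁺ʳ u (S∖T⊆v (∈-∖⁺ S T y∈S (proj₂ (∈-∖⁻ B T y∈B∖T))))
  ... | no y∉S  = ∈ᵥ-++⁺ˡ v (B∖S⊆u (∈-∖⁺ B S (proj₁ (∈-∖⁻ B T y∈B∖T)) y∉S))

  ¬maximal⇒⊂ : ∀ {𝓕 : Subset E → Set} {I} → 𝓕 I → ¬ Maximal 𝓕 I →
               Σ[ B ∈ Subset E ] (𝓕 B × I ⊆ B × Σ[ y ∈ E ] (y ∈ B × y ∉ I))
  ¬maximal⇒⊂ 𝓕I ¬I-max = dne λ no-superset → ¬I-max (𝓕I , λ B 𝓕B I⊆B y y∈B →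
    dne λ y∉I → no-superset (B , 𝓕B , I⊆B , y , y∈B , y∉I))

  few-or-many : (P : E → Set) (n : ℕ) → Distinct P n ⊎ Σ[ m ∈ ℕ ] (m < n × Enumeration P m)
  few-or-many P zero = inj₁ ([] , (λ { {()} }) , λ ())
  few-or-many P (suc n) with few-or-many P n
  ... | inj₂ (m , m<n , e) = inj₂ (m , m<n⇒m<1+n m<n , e)
  ... | inj₁ (d , d-inj , d∈P) with lem {Σ[ y ∈ E ] (P y × ¬ y ∈ᵥ d)}
  ...   | yes (y , Py , y∉d) =
          inj₁ (y ∷ d , injective-∷ y∉d d-inj , λ { zero → Py ; (suc i) → d∈P i })
  ...   | no no-more = inj₂ (n , n<1+n n , record
          { elements = d ; injective = d-inj ; sound = d∈P
          ; complete = λ Py → dne λ y∉d → no-more (_ , Py , y∉d) })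

  module _ (M : Matroid E) where

    open IsMatroid (isMatroid M)

    Base : Subset E → Set
    Base = Maximal (indep M)

    extend-to-base : ∀ {I} → indep M I → Σ[ B ∈ Subset E ] (Base B × I ⊆ B)
    extend-to-base {I} I-indep with IM I (λ _ → true) I-indep (λ _ _ → refl)
    ... | B , (B-indep , I⊆B , _) , B-max =
      B , (B-indep , λ C C-indep B⊆C → B-max C (C-indep , ⊆-trans I⊆B B⊆C , λ _ _ → refl) B⊆C) , I⊆B

    record Extension (I : Subset E) (n : ℕ) : Set where
      field
        new           : Vector E n
        new-injective : Injective _≡_ _≡_ new
        new-∉         : ∀ i → new i ∉ I
        independent   : indep M (I ∪ᵥ new)

    open Extension

    extension-within : ∀ {n B I} {d : Vector E n} → indep M B → I ⊆ B →
                       Injective _≡_ _≡_ d → (∀ i → d i ∈ (B ∖ I)) → Extension I n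
    extension-within {B = B} {I} {d} B-indep I⊆B d-inj d⊆B∖I = record
      { new           = d
      ; new-injective = d-inj
      ; new-∉         = proj₂ ∘ ∈-∖⁻ B I ∘ d⊆B∖I
      ; independent   = I2 _ _ B-indep (∪ᵥ-least I⊆B (proj₁ ∘ ∈-∖⁻ B I ∘ d⊆B∖I))
      }

    extension⇒indep : ∀ {I n} → Extension I n → indep M I
    extension⇒indep e = I2 _ _ (independent e) ∪ᵥ⁺ˡ

    extension⇒indep[] : ∀ {I n} → Extension I n → indep[ n ] M I
    extension⇒indep[] {I} e = extension⇒indep e , I ∪ᵥ new e , independent e , ∪ᵥ⁺ˡ ,
      enumeration⇒hasSize (record
        { elements  = new e
        ; injective = new-injective e
        ; sound     = λ i → ∈-∖⁺ (I ∪ᵥ new e) I (∪ᵥ⁺ʳ i) (new-∉ e i)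
        ; complete  = λ y∈J∖I → let y∈J , y∉I = ∈-∖⁻ (I ∪ᵥ new e) I y∈J∖I in
                        [ ⊥-elim ∘ y∉I , id ] (∪ᵥ⁻ y∈J)
        })

    indep[]⇒extension : ∀ {I n} → indep[ n ] M I → Extension I n
    indep[]⇒extension (_ , J , J-indep , I⊆J , J∖I-size) =
      extension-within J-indep I⊆J injective sound
      where open Enumeration (hasSize⇒enumeration J∖I-size)

    extension-antitone : ∀ {I J n} → I ⊆ J → Extension J n → Extension I n
    extension-antitone I⊆J e = record
      { new           = new e
      ; new-injective = new-injective e
      ; new-∉         = λ i → new-∉ e i ∘ I⊆J _
      ; independent   = I2 _ _ (independent e) (∪ᵥ-least (⊆-trans I⊆J ∪ᵥ⁺ˡ) ∪ᵥ⁺ʳ)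
      }

    extension-∷ : ∀ {I x n} → x ∉ I → Extension (insert I x) n → Extension I (suc n)
    extension-∷ {I} {x} x∉I e = record
      { new           = x ∷ new e
      ; new-injective = injective-∷ (λ (i , eq) → new-∉ e i (insert⁺ (inj₂ eq))) (new-injective e)
      ; new-∉         = λ { zero → x∉I ; (suc i) → new-∉ e i ∘ insert⁺ˡ _ }
      ; independent   = I2 _ _ (independent e)
          (∪ᵥ-least (⊆-trans insert⁺ˡ ∪ᵥ⁺ˡ) λ { zero → ∪ᵥ⁺ˡ _ insert⁺ʳ ; (suc i) → ∪ᵥ⁺ʳ i })
      }

    extension-removeAt : ∀ {I n} (e : Extension I (suc n)) i → Extension (insert I (new e i)) n
    extension-removeAt e i = record
      { new           = removeAt (new e) i
      ; new-injective = punchIn-injective i _ _ ∘ new-injective e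
      ; new-∉         = λ j → [ new-∉ e (punchIn i j) , punchInᵢ≢i i j ∘ new-injective e ] ∘ insert⁻
      ; independent   = I2 _ _ (independent e)
          (∪ᵥ-least (insert-least ∪ᵥ⁺ˡ (∪ᵥ⁺ʳ i)) (∪ᵥ⁺ʳ ∘ punchIn i))
      }

    extension-of-⊂ : ∀ {I B y n} → I ⊆ B → y ∈ B → y ∉ I → Extension B n → Extension I (suc n)
    extension-of-⊂ I⊆B y∈B y∉I = extension-∷ y∉I ∘ extension-antitone (insert-least I⊆B y∈B)

    -- If the head of the extension is outside X, the independent set Y = I ∪ tail is not a
    -- base, so (I3) against X supplies a replacement for the head.
    exchange-into-base : ∀ {X I n} → Base X → Extension I (suc n) →
                         Σ[ x ∈ E ] (x ∈ X × x ∉ I × Extension (insert I x) n)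
    exchange-into-base {X} {I} {n} X-base e with lem {new e zero ∈ X}
    ... | yes h∈X = new e zero , h∈X , new-∉ e zero , extension-removeAt e zero
    ... | no _    = replace-head (I3 Y X Y-indep X-base Y-not-base)
      where
        tail : Vector E n
        tail = new e ∘ suc

        Y : Subset E
        Y = I ∪ᵥ tail

        Y⊆I∪new : Y ⊆ I ∪ᵥ new e
        Y⊆I∪new = ∪ᵥ-least ∪ᵥ⁺ˡ (∪ᵥ⁺ʳ ∘ suc)

        Y-indep : indep M Y
        Y-indep = I2 _ _ (independent e) Y⊆I∪new

        Y-not-base : ¬ Base Y
        Y-not-base (_ , Y-max) with ∪ᵥ⁻ (Y-max _ (independent e) Y⊆I∪new _ (∪ᵥ⁺ʳ zero))
        ... | inj₁ h∈I      = new-∉ e zero h∈I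
        ... | inj₂ (i , eq) = contradiction (new-injective e eq) λ ()

        replace-head : Σ[ x ∈ E ] (x ∈ (X ∖ Y) × (∀ J → IsInsert Y x J → indep M J)) →
                       Σ[ x ∈ E ] (x ∈ X × x ∉ I × Extension (insert I x) n)
        replace-head (x , x∈X∖Y , Y+x-indep) = x , x∈X , x∉Y ∘ ∪ᵥ⁺ˡ _ , record
          { new           = tail
          ; new-injective = suc-injective ∘ new-injective e
          ; new-∉         = λ i →
              [ new-∉ e (suc i) , (λ eq → x∉Y (subst (_∈ Y) eq (∪ᵥ⁺ʳ i))) ] ∘ insert⁻
          ; independent   = I2 _ _ (Y+x-indep (insert Y x) isInsert-insert)
              (∪ᵥ-least (insert-least (⊆-trans ∪ᵥ⁺ˡ insert⁺ˡ) insert⁺ʳ) (insert⁺ˡ _ ∘ ∪ᵥ⁺ʳ))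
          }
          where
            x∈X : x ∈ X
            x∈X = proj₁ (∈-∖⁻ X Y x∈X∖Y)

            x∉Y : x ∉ Y
            x∉Y = proj₂ (∈-∖⁻ X Y x∈X∖Y)

    extension-into-base : ∀ {X I n} → Base X → Extension I n →
                          Σ[ e ∈ Extension I n ] (∀ i → new e i ∈ X)
    extension-into-base {n = zero} _ e = e , λ ()
    extension-into-base {n = suc n} X-base e with exchange-into-base X-base e
    ... | x , x∈X , x∉I , rest with extension-into-base X-base rest
    ...   | rest′ , rest′⊆X = extension-∷ x∉I rest′ , λ { zero → x∈X ; (suc i) → rest′⊆X i }

    extension-size-≤ : ∀ {B I m n} {s : Vector E m} → Base B → B ∖ I ⊆ᵥ s →
                       Extension I n → n ≤ m
    extension-size-≤ {B} {I} B-base B∖I⊆s e with extension-into-base B-base e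
    ... | e′ , e′⊆B =
      injective-⊆-image⇒≤ (new-injective e′) λ i → B∖I⊆s (∈-∖⁺ B I (e′⊆B i) (new-∉ e′ i))

    complement-⊆ᵥ⇒maximal[] : ∀ {B I k} {s : Vector E k} → Base B → B ∖ I ⊆ᵥ s →
                               ∀ J → indep[ k ] M J → I ⊆ J → J ⊆ I
    complement-⊆ᵥ⇒maximal[] B-base B∖I⊆s J Jₖ I⊆J y y∈J = dne λ y∉I →
      1+n≰n (extension-size-≤ B-base B∖I⊆s (extension-of-⊂ I⊆J y∈J y∉I (indep[]⇒extension Jₖ)))

    maximal[]⇒complement-⊆ᵥ : ∀ {B I k} → Maximal (indep[ k ] M) I → (e : Extension I k) →
                               indep M B → I ∪ᵥ new e ⊆ B → B ∖ I ⊆ᵥ new e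
    maximal[]⇒complement-⊆ᵥ {B} {I} {k} (_ , I-max) e B-indep I∪e⊆B {y} y∈B∖I =
      dne λ y∉e → y∉I (I-max (insert I y) (extension⇒indep[] (e+y y∉e)) insert⁺ˡ y insert⁺ʳ)
      where
        y∈B : y ∈ B
        y∈B = proj₁ (∈-∖⁻ B I y∈B∖I)

        y∉I : y ∉ I
        y∉I = proj₂ (∈-∖⁻ B I y∈B∖I)

        e+y : ¬ y ∈ᵥ new e → Extension (insert I y) k
        e+y y∉e = extension-within B-indep (insert-least (⊆-trans ∪ᵥ⁺ˡ I∪e⊆B) y∈B) (new-injective e)
          λ i → ∈-∖⁺ B (insert I y) (I∪e⊆B _ (∪ᵥ⁺ʳ i))
                  ([ new-∉ e i , (λ eq → y∉e (i , eq)) ] ∘ insert⁻)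

    extension-meets-maximal[] : ∀ {I I′ k} → Maximal (indep[ k ] M) I′ → Extension I (suc k) →
                                Σ[ e ∈ Extension I (suc k) ] Σ[ i ∈ Fin (suc k) ] new e i ∈ I′
    extension-meets-maximal[] {I} {I′} I′-max e =
      let f                     = indep[]⇒extension (proj₁ I′-max)
          B , B-base , I′∪f⊆B   = extend-to-base (independent f)
          B∖I′⊆f                = maximal[]⇒complement-⊆ᵥ I′-max f (proj₁ B-base) I′∪f⊆B
          e′ , e′⊆B             = extension-into-base B-base e
      in e′ , dne λ none → 1+n≰n (injective-⊆-image⇒≤ (new-injective e′)
                λ i → B∖I′⊆f (∈-∖⁺ B I′ (e′⊆B i) (none ∘ (i ,_))))

    -- I′ is BX with r elements of BX ∖ I removed, so that B ∖ I′ has exactly f + r elements.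
    -- BX ∖ I has r elements to spare: B ∖ I lies in (B ∖ BX) ∪ (BX ∖ I) and I has an
    -- (f + r)-extension.
    maximal[]-between : ∀ {B BX I f r} → Base B → BX ⊆ B → I ⊆ BX →
                        Enumeration (_∈ (B ∖ BX)) f → Extension I (f + r) →
                        Σ[ I′ ∈ Subset E ] (I ⊆ I′ × I′ ⊆ BX × Maximal (indep[ f + r ] M) I′)
    maximal[]-between {B} {BX} {I} {f} {r} B-base BX⊆B I⊆BX B∖BX I⁺ with few-or-many (_∈ (BX ∖ I)) r
    ... | inj₂ (m , m<r , BX∖I) = contradiction
          (extension-size-≤ B-base (∖-⊆ᵥ-++ (complete B∖BX) (complete BX∖I) BX⊆B) I⁺)
          (<⇒≱ (+-monoʳ-< f m<r))
      where open Enumeration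
    ... | inj₁ (g , g-inj , g⊆BX∖I) =
          I′ , I⊆I′ , I′⊆BX , extension⇒indep[] I′⁺ , complement-⊆ᵥ⇒maximal[] B-base B∖I′⊆h
      where
        open Enumeration B∖BX

        I′ : Subset E
        I′ = BX ∖ ⟦ _∈ᵥ g ⟧

        I′⊆BX : I′ ⊆ BX
        I′⊆BX _ = proj₁ ∘ ∈-∖⁻ BX ⟦ _∈ᵥ g ⟧

        I⊆I′ : I ⊆ I′
        I⊆I′ y y∈I = ∈-∖⁺ BX ⟦ _∈ᵥ g ⟧ (I⊆BX y y∈I) λ y∈g →
          let j , gj≡y = ⟦⟧⁻ (_∈ᵥ g) y∈g
          in proj₂ (∈-∖⁻ BX I (g⊆BX∖I j)) (subst (_∈ I) (sym gj≡y) y∈I)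

        h : Vector E (f + r)
        h = elements ++ g

        h-injective : Injective _≡_ _≡_ h
        h-injective = injective-++ injective g-inj λ i j eq →
          proj₂ (∈-∖⁻ B BX (sound i)) (subst (_∈ BX) (sym eq) (proj₁ (∈-∖⁻ BX I (g⊆BX∖I j))))

        g⊆B∖I′ : ∀ j → g j ∈ (B ∖ I′)
        g⊆B∖I′ j = ∈-∖⁺ B I′ (BX⊆B _ (proj₁ (∈-∖⁻ BX I (g⊆BX∖I j)))) λ gj∈I′ →
          proj₂ (∈-∖⁻ BX ⟦ _∈ᵥ g ⟧ gj∈I′) (⟦⟧⁺ (_∈ᵥ g) (j , refl))

        elements⊆B∖I′ : ∀ i → elements i ∈ (B ∖ I′)
        elements⊆B∖I′ i = let ei∈B , ei∉BX = ∈-∖⁻ B BX (sound i) in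
          ∈-∖⁺ B I′ ei∈B (ei∉BX ∘ I′⊆BX _)

        h⊆B∖I′ : ∀ i → h i ∈ (B ∖ I′)
        h⊆B∖I′ = ++-all {P = _∈ (B ∖ I′)} elements⊆B∖I′ g⊆B∖I′

        I′⁺ : Extension I′ (f + r)
        I′⁺ = extension-within (proj₁ B-base) (⊆-trans I′⊆BX BX⊆B) h-injective h⊆B∖I′

        B∖I′⊆h : B ∖ I′ ⊆ᵥ h
        B∖I′⊆h = ∖-⊆ᵥ-++ complete BX∖I′⊆g BX⊆B
          where
            BX∖I′⊆g : BX ∖ I′ ⊆ᵥ g
            BX∖I′⊆g y∈BX∖I′ = let y∈BX , y∉I′ = ∈-∖⁻ BX I′ y∈BX∖I′ in
              dne λ y∉g → y∉I′ (∈-∖⁺ BX ⟦ _∈ᵥ g ⟧ y∈BX (y∉g ∘ ⟦⟧⁻ (_∈ᵥ g)))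

    indep[]-empty : ∀ {k} → Σ[ I ∈ Subset E ] (indep M I × HasSize I k) → indep[ k ] M (λ _ → false)
    indep[]-empty (I , I-indep , I-size) = extension⇒indep[]
      (extension-within I-indep (λ _ ()) injective λ i → ∈-∖⁺ I (λ _ → false) (sound i) λ ())
      where open Enumeration (hasSize⇒enumeration I-size)

    indep[]-⊆ : ∀ {k} I J → indep[ k ] M J → I ⊆ J → indep[ k ] M I
    indep[]-⊆ I J Jₖ I⊆J = extension⇒indep[] (extension-antitone I⊆J (indep[]⇒extension Jₖ))

    indep[]-augment : ∀ {k} I I′ → indep[ k ] M I → Maximal (indep[ k ] M) I′ →
                      ¬ Maximal (indep[ k ] M) I →
                      Σ[ x ∈ E ] (x ∈ (I′ ∖ I) × (∀ J → IsInsert I x J → indep[ k ] M J))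
    indep[]-augment I I′ Iₖ I′-max ¬I-max =
      let B , Bₖ , I⊆B , y , y∈B , y∉I = ¬maximal⇒⊂ Iₖ ¬I-max
          e , i , x∈I′ = extension-meets-maximal[] I′-max
                           (extension-of-⊂ I⊆B y∈B y∉I (indep[]⇒extension Bₖ))
      in new e i , ∈-∖⁺ I′ I x∈I′ (new-∉ e i) , λ J J≡I+x →
           extension⇒indep[] (extension-antitone (isInsert⇒⊆ J≡I+x) (extension-removeAt e i))

    indep[]-maximal : ∀ {k} I X → indep[ k ] M I → I ⊆ X →
                      Σ[ B ∈ Subset E ] Maximal (λ J → indep[ k ] M J × I ⊆ J × J ⊆ X) B
    indep[]-maximal {k} I X Iₖ I⊆X with IM I X (proj₁ Iₖ) I⊆X
    ... | BX , (BX-indep , I⊆BX , BX⊆X) , BX-max with extend-to-base BX-indep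
    ... | B , B-base , BX⊆B with few-or-many (_∈ (B ∖ BX)) k
    ...   | inj₁ (d , d-inj , d⊆B∖BX) =
            BX ,
            (extension⇒indep[] (extension-within (proj₁ B-base) BX⊆B d-inj d⊆B∖BX) , I⊆BX , BX⊆X) ,
            λ J (Jₖ , I⊆J , J⊆X) → BX-max J (proj₁ Jₖ , I⊆J , J⊆X)
    ...   | inj₂ (f , f<k , B∖BX) with m≤n⇒∃[o]m+o≡n (<⇒≤ f<k)
    ...     | r , refl with maximal[]-between B-base BX⊆B I⊆BX B∖BX (indep[]⇒extension Iₖ)
    ...       | I′ , I⊆I′ , I′⊆BX , I′ₖ , I′-max =
                I′ , (I′ₖ , I⊆I′ , ⊆-trans I′⊆BX BX⊆X) , λ J (Jₖ , _) → I′-max J Jₖ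

proposition4p13 : ExcludedMiddle 0ℓ → {E : Set} → (M : Matroid E) → (k : ℕ) →
                    Σ[ I ∈ Subset E ] (indep M I × HasSize I k) →
                    IsMatroid E (indep[ k ] M)
proposition4p13 lem M k rank≥k = record
  { I1 = indep[]-empty M rank≥k
  ; I2 = indep[]-⊆ M
  ; I3 = indep[]-augment M
  ; IM = indep[]-maximal M
  }
  where open Classical lem
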